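{- Let $\mathbf{Set}_\omega$ be the full subcategory of $\mathbf{Set}$ whose objects are the finite ordinals $n=\{0,1,\dots,n-1\}$, equipped with the strict monoidal finite-product structure described in the context. Let $\mathcal{C}$ be the category with finite, strict monoidal, products freely generated by the countable set $P=\{p_1,p_2,\dots\}$ of objects, and let $H\colon\mathcal{C}\to\mathbf{Set}_\omega$ be the unique functor that preserves the finite-product structure on the nose and maps each generator $p_n$ to the $n$-th prime number $\mathbf{p}_n$ (so $\mathbf{p}_1=2,\mathbf{p}_2=3,\dots$). Then $H$ is faithful.
   Context: Product structure on $\mathbf{Set}_\omega$: the terminal object is $1$ (with the unique maps $n\to 1$); the product of objects $n,m$ is the ordinal $n\cdot m$. For $n,m$ let $\iota\colon n\times m\to n\cdot m$ be the bijection $\iota(i,j)=i\cdot m+j$. The product of arrows $f_1\colon n_1\to m_1$, $f_2\colon n_2\to m_2$ is $f_1\cdot f_2=\iota\circ(f_1\times f_2)\circ\iota^{ -1}\colon n_1\cdot n_2\to m_1\cdot m_2$, where $(f_1\times f_2)(i_1,i_2)=(f_1(i_1),f_2(i_2))$. The projections $n\cdot m\to n$ and $n\cdot m\to m$ are $\pi_1\circ\iota^{ -1}$ and $\pi_2\circ\iota^{ -1}$, and the diagonal $n\to n\cdot n$ is $\iota\circ\Delta$ with $\Delta(i)=(i,i)$. This is a category with finite, strict monoidal, products. Let $\mathbf{Cat}_\times$ be the category whose objects are categories with finite, strict monoidal, products and whose arrows are functors preserving this structure on the nose. $\mathcal{C}$ is the image of $P$ under the left adjoint of the forgetful functor $\mathbf{Cat}_\times\to\mathbf{Set}$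 sending a category to its set of objects; its objects are the finite sequences of elements of $P$ (product of objects is concatenation, the terminal object is the empty sequence). -}

module Defs where

open import Data.Nat using (ℕ; zero; suc; _*_; _+_; _!)
open import Data.Nat.Primality using (prime?)
open import Data.Fin using (Fin; combine; remQuot)
open import Data.List using (List; []; _∷_; length; lookup)
open import Data.Product using (Σ; proj₁; proj₂)
open import Relation.Nullary using (yes; no)
open import Relation.Binary.PropositionalEquality using (_≡_; subst)

-- The sequence of prime numbers (0-indexed: nthPrime 0 = 2, nthPrime 1 = 3, …).
-- The generator p_{k+1} of the paper is encoded by the natural number k.

-- first prime among start, start+1, …, start+fuel-1 (fallback: start + fuel)
firstPrimeFrom : (fuel start : ℕ) → ℕ
firstPrimeFrom zero       start = start
firstPrimeFrom (suc fuel) start with prime? start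
... | yes _ = start
... | no  _ = firstPrimeFrom fuel (suc start)

-- there is always a prime in (p, p!+1], so fuel p! suffices
nthPrime : ℕ → ℕ
nthPrime zero    = 2
nthPrime (suc n) = firstPrimeFrom ((nthPrime n) !) (suc (nthPrime n))

-- The free category 𝒞 with finite, strict monoidal, products on the
-- generating set P = ℕ (generator k stands for p_{k+1}).
-- Objects: finite sequences of generators; product = concatenation,
-- terminal object = [].
-- Arrows Γ → Δ: the tuples ⟨π_{φ 0}, …, π_{φ (m-1)}⟩ of projections,
-- i.e. maps φ : Fin |Δ| → Fin |Γ| with Γ[φ j] = Δ[j].

Obj : Set
Obj = List ℕ

Hom : Obj → Obj → Set
Hom Γ Δ = Σ (Fin (length Δ) → Fin (length Γ)) λ φ →
            (j : Fin (length Δ)) → lookup Γ (φ j) ≡ lookup Δ j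

-- equality of arrows (the proof component is a proof of an equation in ℕ,
-- hence irrelevant)
_≈Hom_ : ∀ {Γ Δ : Obj} → Hom Γ Δ → Hom Γ Δ → Set
_≈Hom_ {Γ} {Δ} f g = (j : Fin (length Δ)) → proj₁ f j ≡ proj₁ g j

idHom : ∀ Γ → Hom Γ Γ
idHom Γ = (λ j → j) Data.Product., (λ j → Relation.Binary.PropositionalEquality.refl)

_∘Hom_ : ∀ {Γ Δ Θ} → Hom Δ Θ → Hom Γ Δ → Hom Γ Θ
_∘Hom_ {Γ} {Δ} {Θ} g f =
  (λ k → proj₁ f (proj₁ g k)) Data.Product.,
  (λ k → Relation.Binary.PropositionalEquality.trans (proj₂ f (proj₁ g k)) (proj₂ g k))

-- Data.Fin.combine i j = i * m + j is the bijection ι, and remQuot is ι⁻¹.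

HObj : Obj → ℕ
HObj []      = 1
HObj (a ∷ Γ) = nthPrime a * HObj Γ

proj : (Γ : Obj) → Fin (HObj Γ) → (i : Fin (length Γ)) → Fin (nthPrime (lookup Γ i))
proj (a ∷ Γ) x Fin.zero    = proj₁ (remQuot {nthPrime a} (HObj Γ) x)
proj (a ∷ Γ) x (Fin.suc i) = proj Γ (proj₂ (remQuot {nthPrime a} (HObj Γ) x)) i

tuple : (Δ : Obj) → ((j : Fin (length Δ)) → Fin (nthPrime (lookup Δ j))) → Fin (HObj Δ)
tuple []      h = Fin.zero
tuple (b ∷ Δ) h = combine (h Fin.zero) (tuple Δ (λ j → h (Fin.suc j)))

HHom : ∀ Γ Δ → Hom Γ Δ → Fin (HObj Γ) → Fin (HObj Δ)
HHom Γ Δ f x =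
  tuple Δ (λ j → subst (λ a → Fin (nthPrime a)) (proj₂ f j) (proj Γ x (proj₁ f j)))

Faithful-H : Set
Faithful-H = ∀ (Γ Δ : Obj) (f g : Hom Γ Δ) →
             (∀ x → HHom Γ Δ f x ≡ HHom Γ Δ g x) → _≈Hom_ {Γ} {Δ} f g

{-# OPTIONS --safe #-}
module Submission where

-- The arrow f : Γ → Δ is recovered from H f because distinct projections
-- H Γ → H(p_a) are distinct as functions: every H(p_a) = nthPrime a has at
-- least the two elements 0 and 1, so the point of H Γ whose k-th coordinate
-- is 1 and all others 0 tells the k-th projection apart from every other.

open import Defs
open import Data.Nat using (ℕ; zero; suc; _≤_; _!; s≤s; z≤n)
open import Data.Nat.Properties using (≤-refl; ≤-trans; n≤1+n; m≤n⇒m≤1+n)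
open import Data.Nat.Primality using (prime?)
open import Data.Fin using (Fin; toℕ; fromℕ<; remQuot; _≟_)
open import Data.Fin.Properties using (toℕ-fromℕ<; remQuot-combine)
open import Data.List using (_∷_; length; lookup)
open import Data.Product using (proj₁; proj₂)
open import Function using (_∘_)
open import Relation.Nullary using (yes; no; contradiction)
open import Relation.Binary.PropositionalEquality
open ≡-Reasoning

start≤firstPrimeFrom : ∀ fuel start → start ≤ firstPrimeFrom fuel start
start≤firstPrimeFrom zero       start = ≤-refl
start≤firstPrimeFrom (suc fuel) start with prime? start
... | yes _ = ≤-refl
... | no  _ = ≤-trans (n≤1+n start) (start≤firstPrimeFrom fuel (suc start))

2≤nthPrime : ∀ n → 2 ≤ nthPrime n
2≤nthPrime zero    = s≤s (s≤s z≤n)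
2≤nthPrime (suc n) =
  ≤-trans (m≤n⇒m≤1+n (2≤nthPrime n))
          (start≤firstPrimeFrom (nthPrime n !) (suc (nthPrime n)))

toℕ-subst : ∀ {A : Set} (size : A → ℕ) {a b} (a≡b : a ≡ b) (x : Fin (size a)) →
            toℕ (subst (Fin ∘ size) a≡b x) ≡ toℕ x
toℕ-subst size refl x = refl

proj-tuple : ∀ Γ h i → proj Γ (tuple Γ h) i ≡ h i
proj-tuple (a ∷ Γ) h Fin.zero =
  cong proj₁ (remQuot-combine {nthPrime a} (h Fin.zero) (tuple Γ (h ∘ Fin.suc)))
proj-tuple (a ∷ Γ) h (Fin.suc i) = begin
  proj Γ (proj₂ (remQuot {nthPrime a} (HObj Γ) (tuple (a ∷ Γ) h))) i
    ≡⟨ cong (λ y → proj Γ (proj₂ y) i) (remQuot-combine {nthPrime a} (h Fin.zero) (tuple Γ (h ∘ Fin.suc))) ⟩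
  proj Γ (tuple Γ (h ∘ Fin.suc)) i
    ≡⟨ proj-tuple Γ (h ∘ Fin.suc) i ⟩
  h (Fin.suc i) ∎

toℕ-proj-HHom : ∀ Γ Δ (f : Hom Γ Δ) x j →
                toℕ (proj Δ (HHom Γ Δ f x) j) ≡ toℕ (proj Γ x (proj₁ f j))
toℕ-proj-HHom Γ Δ f x j = begin
  toℕ (proj Δ (HHom Γ Δ f x) j)
    ≡⟨ cong toℕ (proj-tuple Δ _ j) ⟩
  toℕ (subst (Fin ∘ nthPrime) (proj₂ f j) (proj Γ x (proj₁ f j)))
    ≡⟨ toℕ-subst nthPrime (proj₂ f j) _ ⟩
  toℕ (proj Γ x (proj₁ f j)) ∎

indicator : ∀ Γ (k i : Fin (length Γ)) → Fin (nthPrime (lookup Γ i))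
indicator Γ k i with i ≟ k
... | yes _ = fromℕ< (2≤nthPrime (lookup Γ i))
... | no  _ = fromℕ< (≤-trans (s≤s z≤n) (2≤nthPrime (lookup Γ i)))

toℕ-indicator-self : ∀ Γ k → toℕ (indicator Γ k k) ≡ 1
toℕ-indicator-self Γ k with k ≟ k
... | yes _   = toℕ-fromℕ< (2≤nthPrime (lookup Γ k))
... | no  k≢k = contradiction refl k≢k

toℕ-indicator-other : ∀ Γ {k i} → i ≢ k → toℕ (indicator Γ k i) ≡ 0
toℕ-indicator-other Γ {k} {i} i≢k with i ≟ k
... | yes i≡k = contradiction i≡k i≢k
... | no  _   = toℕ-fromℕ< (≤-trans (s≤s z≤n) (2≤nthPrime (lookup Γ i)))

proj-injective : ∀ Γ {k i} →
                 (∀ x → toℕ (proj Γ x k) ≡ toℕ (proj Γ x i)) → k ≡ i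
proj-injective Γ {k} {i} same with i ≟ k
... | yes i≡k = sym i≡k
... | no  i≢k = contradiction 1≡0 λ ()
  where
  x = tuple Γ (indicator Γ k)
  1≡0 : 1 ≡ 0
  1≡0 = begin
    1                           ≡⟨ sym (toℕ-indicator-self Γ k) ⟩
    toℕ (indicator Γ k k)       ≡⟨ cong toℕ (sym (proj-tuple Γ _ k)) ⟩
    toℕ (proj Γ x k)            ≡⟨ same x ⟩
    toℕ (proj Γ x i)            ≡⟨ cong toℕ (proj-tuple Γ _ i) ⟩
    toℕ (indicator Γ k i)       ≡⟨ toℕ-indicator-other Γ i≢k ⟩
    0                           ∎

proposition2 : Faithful-H
proposition2 Γ Δ f g Hf≗Hg j = proj-injective Γ λ x → begin
  toℕ (proj Γ x (proj₁ f j))    ≡⟨ sym (toℕ-proj-HHom Γ Δ f x j) ⟩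
  toℕ (proj Δ (HHom Γ Δ f x) j) ≡⟨ cong (λ y → toℕ (proj Δ y j)) (Hf≗Hg x) ⟩
  toℕ (proj Δ (HHom Γ Δ g x) j) ≡⟨ toℕ-proj-HHom Γ Δ g x j ⟩
  toℕ (proj Γ x (proj₁ g j))    ∎
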